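{- For odd $n\geq 3$, let $\mathrm{Dic}_n=\langle a,b,c\mid a^n=b^2=c^2=abc\rangle$ be the dicyclic group of order $4n$. Then Player 2 has a winning strategy for $\texttt{REL}(\mathrm{Dic}_n,\{a,b,c\})$.
   Context: Game $\texttt{REL}(G,S)$: $G$ is a finite group and $S$ a generating set with $e\notin S$. Two players alternate turns, Player 1 first, starting from the empty word $w_0$. On turn $n$ the current player chooses $s_n\in S\cup S^{ -1}$, subject to $s_n\neq s_{n-1}^{ -1}$ when $n>1$, and forms $w_n=w_{n-1}s_n$. If $w_n$ represents the same element of $G$ as some $w_k$ with $0\le k<n$, the player who formed $w_n$ wins. If a player has no legal move, that player loses. -}

module Defs where

open import Level using (_⊔_)
open import Algebra.Bundles.Raw using (RawGroup)
open import Data.Bool using (Bool; true; false)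
open import Data.Fin using (Fin; toℕ)
open import Data.List using (List; []; _∷_)
open import Data.List.Relation.Unary.Any using (Any)
open import Data.Maybe using (Maybe; just; nothing)
open import Data.Nat using (ℕ; _+_; _*_; _∸_; NonZero)
open import Data.Nat.DivMod using (_mod_)
open import Data.Nat.Properties using (m*n≢0)
open import Data.Product using (_×_; _,_)
open import Data.Sum using (_⊎_)
open import Relation.Binary.PropositionalEquality using (_≡_)
open import Relation.Nullary using (¬_)

-- A position is described by
--   cur  : the element represented by the current word w_{n-1}
--   vis  : the elements represented by w_0, ..., w_{n-1}
--   last : the previous move s_{n-1} (nothing before the first move)

module REL {c ℓ} (G : RawGroup c ℓ) (S : List (RawGroup.Carrier G)) where
  open RawGroup G

  InGens : Carrier → Set (c ⊔ ℓ)
  InGens g = Any (λ s → g ≈ s) S ⊎ Any (λ s → g ≈ s ⁻¹) S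

  Legal : Maybe Carrier → Carrier → Set (c ⊔ ℓ)
  Legal nothing  g = InGens g
  Legal (just p) g = InGens g × ¬ (g ≈ p ⁻¹)

  Repeats : Carrier → List Carrier → Set (c ⊔ ℓ)
  Repeats x vis = Any (λ y → x ≈ y) vis

  -- Win  cur vis last : the player to move has a winning strategy
  -- Lose cur vis last : the player to move has no winning strategy,
  --                     i.e. the opponent has a winning strategy
  -- (inductive: every play following the strategy ends in finitely many moves)
  data Win  (cur : Carrier) (vis : List Carrier) (last : Maybe Carrier) : Set (c ⊔ ℓ)
  data Lose (cur : Carrier) (vis : List Carrier) (last : Maybe Carrier) : Set (c ⊔ ℓ)

  data Win cur vis last where
    win-now  : (g : Carrier) → Legal last g → Repeats (cur ∙ g) vis → Win cur vis last
    win-move : (g : Carrier) → Legal last g → ¬ Repeats (cur ∙ g) vis →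
               Lose (cur ∙ g) ((cur ∙ g) ∷ vis) (just g) → Win cur vis last

  data Lose cur vis last where
    lose : ((g : Carrier) → Legal last g →
              ¬ Repeats (cur ∙ g) vis × Win (cur ∙ g) ((cur ∙ g) ∷ vis) (just g)) →
           Lose cur vis last

  Player2Wins : Set (c ⊔ ℓ)
  Player2Wins = Lose ε (ε ∷ []) nothing

-- Elements are pairs (k , t) standing for α^k x^t, with α of order 2n,
-- x^2 = α^n, x α x⁻¹ = α⁻¹.  Then a = α = (1,false), b = x = (0,true),
-- c = α x = (1,true), and a^n = b^2 = c^2 = abc = (n,false).

module Dicyclic (n : ℕ) .{{_ : NonZero n}} where
  instance
    nz2n : NonZero (2 * n)
    nz2n = m*n≢0 2 n

  Elt : Set
  Elt = Fin (2 * n) × Bool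

  _⊕_ : Fin (2 * n) → Fin (2 * n) → Fin (2 * n)
  i ⊕ j = (toℕ i + toℕ j) mod (2 * n)

  neg : Fin (2 * n) → Fin (2 * n)
  neg i = (2 * n ∸ toℕ i) mod (2 * n)

  nF : Fin (2 * n)
  nF = n mod (2 * n)

  oneF : Fin (2 * n)
  oneF = 1 mod (2 * n)

  zeroF : Fin (2 * n)
  zeroF = 0 mod (2 * n)

  mul : Elt → Elt → Elt
  mul (k , false) (m , t)     = (k ⊕ m , t)
  mul (k , true)  (m , false) = (k ⊕ neg m , true)
  mul (k , true)  (m , true)  = ((k ⊕ neg m) ⊕ nF , false)

  inv : Elt → Elt
  inv (k , false) = (neg k , false)
  inv (k , true)  = (k ⊕ nF , true)

  Dic : RawGroup _ _
  Dic = record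
    { Carrier = Elt
    ; _≈_     = _≡_
    ; _∙_     = mul
    ; ε       = (zeroF , false)
    ; _⁻¹     = inv
    }

  gen-a gen-b gen-c : Elt
  gen-a = (oneF , false)
  gen-b = (zeroF , true)
  gen-c = (oneF , true)

  gens : List Elt
  gens = gen-a ∷ gen-b ∷ gen-c ∷ []

module Submission where

-- Let H = ⟨α²⟩, the elements α^k with k even. Because n is odd, Dic_n / H is cyclic of
-- order 4, generated by the coset of x, and each nontrivial coset contains exactly two of
-- the six letters: {a, a⁻¹}, {b, c⁻¹} and {c, b⁻¹}. Player 2 answers each letter with the
-- letter of the same sign in the inverse coset (a ↦ a, b ↦ c, c ↦ b, and likewise for the
-- inverses), so every round returns to H while every move of Player 1 leaves it. If a move
-- h g of Player 1 hit an earlier position h′ g′, the letters g, g′ would lie in one coset: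
-- either g = g′, so h = h′ and Player 2 had already repeated, or g is the partner of g′,
-- which forces h = h′ g′ (reply g′) and g = (reply g′)⁻¹, an illegal move. So Player 1
-- never wins, and as the group is finite the play ends with a win for Player 2.

open import Defs
open import Level using (0ℓ)
open import Algebra.Bundles using (AbelianGroup)
open import Algebra.Bundles.Raw using (RawGroup)
open import Algebra.Consequences.Propositional using (comm∧idʳ⇒id; comm∧invʳ⇒inv)
import Algebra.Properties.AbelianGroup
open import Algebra.Structures using (IsAbelianGroup)
open import Data.Bool using (Bool; true; false; not)
import Data.Bool.Properties as Bool
open import Data.Empty using (⊥-elim)
open import Data.Fin using (Fin; toℕ)
import Data.Fin.Properties as Fin
open import Data.Fin.Properties using (toℕ-injective; toℕ<n; toℕ-fromℕ<)
open import Data.List using (List; []; _∷_; filter; length; allFin; cartesianProduct)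
open import Data.List.Membership.Propositional using (_∈_; _∉_)
open import Data.List.Membership.Propositional.Properties
  using (∈-filter⁺; ∈-filter⁻; ∈-resp-≋; ∈-allFin; ∈-cartesianProduct⁺)
open import Data.List.Relation.Binary.Equality.Propositional using (≋-sym)
open import Data.List.Relation.Binary.Sublist.Propositional using (_⊆_; ⊆-refl)
open import Data.List.Relation.Binary.Sublist.Propositional.Properties using (filter⁺; length-mono-≤; to-≋)
open import Data.List.Relation.Unary.Any using (here; there)
open import Data.Maybe using (Maybe; just; nothing)
open import Data.Nat as ℕ using (ℕ; suc; NonZero; _∸_; _%_; _*_; _<_; _≤_)
open import Data.Nat.DivMod
open import Data.Nat.Divisibility using (_∣_; m∣m*n)
open import Data.Nat.Induction using (<-wellFounded)
import Data.Nat.Properties as ℕ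
open import Data.Product using (_×_; _,_; proj₁; proj₂; ∃-syntax)
open import Data.Product.Properties using (≡-dec)
open import Data.Sum using (_⊎_; inj₁; inj₂)
open import Data.Unit using (⊤; tt)
open import Function using (_∘_)
open import Induction.WellFounded using (Acc; acc)
open import Relation.Binary.Definitions using (DecidableEquality)
open import Relation.Binary.PropositionalEquality
open import Relation.Nullary using (¬_; Dec; yes; no; ¬?)

module ℤMod (m : ℕ) .{{_ : NonZero m}} where

  infixl 6 _+_
  _+_ : Fin m → Fin m → Fin m
  i + j = (toℕ i ℕ.+ toℕ j) mod m

  -_ : Fin m → Fin m
  - i = (m ∸ toℕ i) mod m

  0# : Fin m
  0# = 0 mod m

  toℕ-mod : ∀ x → toℕ (x mod m) ≡ x % m
  toℕ-mod x = toℕ-fromℕ< (m%n<n x m)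

  mod-cong : ∀ {x y} → x % m ≡ y % m → x mod m ≡ y mod m
  mod-cong {x} {y} eq = toℕ-injective (trans (toℕ-mod x) (trans eq (sym (toℕ-mod y))))

  %-absorbˡ : ∀ x y → (x % m ℕ.+ y) % m ≡ (x ℕ.+ y) % m
  %-absorbˡ x y = begin
    (x % m ℕ.+ y) % m           ≡⟨ %-distribˡ-+ (x % m) y m ⟩
    (x % m % m ℕ.+ y % m) % m   ≡⟨ cong (λ z → (z ℕ.+ y % m) % m) (m%n%n≡m%n x m) ⟩
    (x % m ℕ.+ y % m) % m       ≡⟨ %-distribˡ-+ x y m ⟨
    (x ℕ.+ y) % m               ∎
    where open ≡-Reasoning

  %-absorbʳ : ∀ x y → (x ℕ.+ y % m) % m ≡ (x ℕ.+ y) % m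
  %-absorbʳ x y = begin
    (x ℕ.+ y % m) % m  ≡⟨ cong (_% m) (ℕ.+-comm x (y % m)) ⟩
    (y % m ℕ.+ x) % m  ≡⟨ %-absorbˡ y x ⟩
    (y ℕ.+ x) % m      ≡⟨ cong (_% m) (ℕ.+-comm y x) ⟩
    (x ℕ.+ y) % m      ∎
    where open ≡-Reasoning

  +-assoc : ∀ i j k → (i + j) + k ≡ i + (j + k)
  +-assoc i j k = mod-cong (begin
    (toℕ (i + j) ℕ.+ toℕ k) % m             ≡⟨ cong (λ z → (z ℕ.+ toℕ k) % m) (toℕ-mod _) ⟩
    ((toℕ i ℕ.+ toℕ j) % m ℕ.+ toℕ k) % m   ≡⟨ %-absorbˡ (toℕ i ℕ.+ toℕ j) (toℕ k) ⟩
    (toℕ i ℕ.+ toℕ j ℕ.+ toℕ k) % m         ≡⟨ cong (_% m) (ℕ.+-assoc (toℕ i) (toℕ j) (toℕ k)) ⟩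
    (toℕ i ℕ.+ (toℕ j ℕ.+ toℕ k)) % m       ≡⟨ %-absorbʳ (toℕ i) (toℕ j ℕ.+ toℕ k) ⟨
    (toℕ i ℕ.+ (toℕ j ℕ.+ toℕ k) % m) % m   ≡⟨ cong (λ z → (toℕ i ℕ.+ z) % m) (toℕ-mod _) ⟨
    (toℕ i ℕ.+ toℕ (j + k)) % m             ∎)
    where open ≡-Reasoning

  +-comm : ∀ i j → i + j ≡ j + i
  +-comm i j = cong (_mod m) (ℕ.+-comm (toℕ i) (toℕ j))

  +-identityʳ : ∀ i → i + 0# ≡ i
  +-identityʳ i = toℕ-injective (begin
    toℕ (i + 0#)                  ≡⟨ toℕ-mod _ ⟩
    (toℕ i ℕ.+ toℕ 0#) % m        ≡⟨ cong (λ z → (toℕ i ℕ.+ z) % m) (toℕ-mod 0) ⟩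
    (toℕ i ℕ.+ 0 % m) % m         ≡⟨ %-absorbʳ (toℕ i) 0 ⟩
    (toℕ i ℕ.+ 0) % m             ≡⟨ cong (_% m) (ℕ.+-identityʳ (toℕ i)) ⟩
    toℕ i % m                     ≡⟨ m<n⇒m%n≡m (toℕ<n i) ⟩
    toℕ i                         ∎)
    where open ≡-Reasoning

  -‿inverseʳ : ∀ i → i + - i ≡ 0#
  -‿inverseʳ i = mod-cong (begin
    (toℕ i ℕ.+ toℕ (- i)) % m        ≡⟨ cong (λ z → (toℕ i ℕ.+ z) % m) (toℕ-mod _) ⟩
    (toℕ i ℕ.+ (m ∸ toℕ i) % m) % m  ≡⟨ %-absorbʳ (toℕ i) (m ∸ toℕ i) ⟩
    (toℕ i ℕ.+ (m ∸ toℕ i)) % m      ≡⟨ cong (_% m) (ℕ.m+[n∸m]≡n (ℕ.<⇒≤ (toℕ<n i))) ⟩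
    m % m                            ≡⟨ n%n≡0 m ⟩
    0                                ≡⟨ m*n%n≡0 0 m ⟨
    0 % m                            ∎)
    where open ≡-Reasoning

  +-isAbelianGroup : IsAbelianGroup _≡_ _+_ 0# -_
  +-isAbelianGroup = record
    { isGroup = record
      { isMonoid = record
        { isSemigroup = record
          { isMagma = record { isEquivalence = isEquivalence ; ∙-cong = cong₂ _+_ }
          ; assoc = +-assoc
          }
        ; identity = comm∧idʳ⇒id +-comm +-identityʳ
        }
      ; inverse = comm∧invʳ⇒inv +-comm -‿inverseʳ
      ; ⁻¹-cong = cong -_
      }
    ; comm = +-comm
    }

  +-abelianGroup : AbelianGroup _ _
  +-abelianGroup = record { isAbelianGroup = +-isAbelianGroup }

  module Parity (2∣m : 2 ∣ m) where

    parity : Fin m → ℕ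
    parity i = toℕ i % 2

    parity-+ : ∀ i j → parity (i + j) ≡ (parity i ℕ.+ parity j) % 2
    parity-+ i j = begin
      toℕ (i + j) % 2                 ≡⟨ cong (_% 2) (toℕ-mod _) ⟩
      (toℕ i ℕ.+ toℕ j) % m % 2       ≡⟨ m∣n⇒o%n%m≡o%m 2 m _ 2∣m ⟩
      (toℕ i ℕ.+ toℕ j) % 2           ≡⟨ %-distribˡ-+ (toℕ i) (toℕ j) 2 ⟩
      (parity i ℕ.+ parity j) % 2     ∎
      where open ≡-Reasoning

    parity-0# : parity 0# ≡ 0
    parity-0# = cong (_% 2) (trans (toℕ-mod 0) (m*n%n≡0 0 m))

    parity-neg : ∀ i → parity (- i) ≡ parity i
    parity-neg i = bits-sum-even (m%n<n (toℕ (- i)) 2) (m%n<n (toℕ i) 2) (begin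
      (parity (- i) ℕ.+ parity i) % 2 ≡⟨ parity-+ (- i) i ⟨
      parity (- i + i)               ≡⟨ cong parity (trans (+-comm (- i) i) (-‿inverseʳ i)) ⟩
      parity 0#                      ≡⟨ parity-0# ⟩
      0                              ∎)
      where
      open ≡-Reasoning
      bits-sum-even : ∀ {a b} → a < 2 → b < 2 → (a ℕ.+ b) % 2 ≡ 0 → a ≡ b
      bits-sum-even {0} {0} _ _ _ = refl
      bits-sum-even {1} {1} _ _ _ = refl
      bits-sum-even {0} {1} _ _ ()
      bits-sum-even {1} {0} _ _ ()
      bits-sum-even {suc (suc _)} (ℕ.s≤s (ℕ.s≤s ())) _ _
      bits-sum-even {_} {suc (suc _)} _ (ℕ.s≤s (ℕ.s≤s ())) _

module Unvisited
  {A : Set} (_≟_ : DecidableEquality A) (elements : List A) (∈-elements : ∀ x → x ∈ elements)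
  where

  open import Data.List.Membership.DecPropositional _≟_ using (_∈?_)

  _∉?_ : (x : A) (V : List A) → Dec (x ∉ V)
  x ∉? V = ¬? (x ∈? V)

  unvisited : List A → ℕ
  unvisited V = length (filter (_∉? V) elements)

  unvisited-∷ : ∀ {x V} → x ∉ V → unvisited (x ∷ V) < unvisited V
  unvisited-∷ {x} {V} x∉V = ℕ.≤∧≢⇒< (length-mono-≤ shrink) λ same-length →
    x-visited (∈-resp-≋ (≋-sym (to-≋ same-length shrink)) x-unvisited)
    where
    shrink : filter (_∉? (x ∷ V)) elements ⊆ filter (_∉? V) elements
    shrink = filter⁺ (_∉? (x ∷ V)) (_∉? V) (λ { refl y∉x∷V y∈V → y∉x∷V (there y∈V) })
               (⊆-refl {x = elements})
    x-unvisited : x ∈ filter (_∉? V) elements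
    x-unvisited = ∈-filter⁺ (_∉? V) (∈-elements x) x∉V
    x-visited : x ∉ filter (_∉? (x ∷ V)) elements
    x-visited x∈ = proj₂ (∈-filter⁻ (_∉? (x ∷ V)) {xs = elements} x∈) (here refl)

module PairingStrategy
  {A : Set} (_∙_ : A → A → A) (ε : A) (_⁻¹ : A → A) (S : List A)
  where

  group : RawGroup 0ℓ 0ℓ
  group = record { Carrier = A ; _≈_ = _≡_ ; _∙_ = _∙_ ; ε = ε ; _⁻¹ = _⁻¹ }

  open REL group S

  legal⇒InGens : ∀ {last g} → Legal last g → InGens g
  legal⇒InGens {nothing} ig       = ig
  legal⇒InGens {just _}  (ig , _) = ig

  module _
    (_≟_ : DecidableEquality A) (elements : List A) (∈-elements : ∀ x → x ∈ elements)
    (∙-⁻¹-cancelʳ : ∀ x y → (x ∙ y) ∙ (y ⁻¹) ≡ x)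
    {Letter : Set} (letter : Letter → A)
    (letter-onto : ∀ {g} → InGens g → ∃[ l ] g ≡ letter l)
    (reply : Letter → A) (reply-legal : ∀ l → Legal (just (letter l)) (reply l))
    (H : A → Set) (H-ε : H ε)
    (H-round : ∀ {h} l → H h → H ((h ∙ letter l) ∙ reply l))
    (H-leave : ∀ {h h′} l → H h → H h′ → h ∙ letter l ≢ h′)
    (H-collide : ∀ {h h′} l l′ → H h → H h′ → h ∙ letter l ≡ h′ ∙ letter l′ →
                 letter l ≡ letter l′ ⊎ letter l ≡ (reply l′ ⁻¹))
    where

    open Unvisited _≟_ elements ∈-elements
    open import Data.List.Membership.DecPropositional _≟_ using (_∈?_)

    ∙-cancelʳ : ∀ {x y z} → x ∙ y ≡ z ∙ y → x ≡ z
    ∙-cancelʳ {x} {y} {z} eq = begin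
      x                  ≡⟨ ∙-⁻¹-cancelʳ x y ⟨
      (x ∙ y) ∙ (y ⁻¹)   ≡⟨ cong (_∙ (y ⁻¹)) eq ⟩
      (z ∙ y) ∙ (y ⁻¹)   ≡⟨ ∙-⁻¹-cancelʳ z y ⟩
      z                  ∎
      where open ≡-Reasoning

    collision : ∀ {h h′} l l′ → H h → H h′ → h ∙ letter l ≡ h′ ∙ letter l′ →
                h ≡ h′ ⊎ (h ≡ (h′ ∙ letter l′) ∙ reply l′ × letter l ≡ (reply l′ ⁻¹))
    collision {h} {h′} l l′ hH h′H eq with H-collide l l′ hH h′H eq
    ... | inj₁ same = inj₁ (∙-cancelʳ (trans eq (cong (h′ ∙_) (sym same))))
    ... | inj₂ ill  = inj₂ (∙-cancelʳ (begin
      h ∙ letter l             ≡⟨ eq ⟩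
      h′ ∙ letter l′           ≡⟨ ∙-⁻¹-cancelʳ (h′ ∙ letter l′) (reply l′) ⟨
      h″ ∙ (reply l′ ⁻¹)       ≡⟨ cong (h″ ∙_) ill ⟨
      h″ ∙ letter l            ∎) , ill)
      where
      open ≡-Reasoning
      h″ : A
      h″ = (h′ ∙ letter l′) ∙ reply l′

    -- A history lists the letters Player 1 chose in the rounds so far, most recent first.
    after : List Letter → A
    after []       = ε
    after (l ∷ ls) = (after ls ∙ letter l) ∙ reply l

    visited : List Letter → List A
    visited []       = ε ∷ []
    visited (l ∷ ls) = after (l ∷ ls) ∷ after ls ∙ letter l ∷ visited ls

    lastMove : List Letter → Maybe A
    lastMove []      = nothing
    lastMove (l ∷ _) = just (reply l)

    Fresh : List Letter → Set
    Fresh []       = ⊤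
    Fresh (l ∷ ls) = after (l ∷ ls) ∉ after ls ∙ letter l ∷ visited ls

    after∈visited : ∀ ls → after ls ∈ visited ls
    after∈visited []      = here refl
    after∈visited (_ ∷ _) = here refl

    H-after : ∀ ls → H (after ls)
    H-after []       = H-ε
    H-after (l ∷ ls) = H-round l (H-after ls)

    ∈-visited-retract : ∀ {h} l ls → H h → h ∙ letter l ∈ visited ls → h ∈ visited ls
    ∈-visited-retract l [] hH (here eq) = ⊥-elim (H-leave l hH H-ε eq)
    ∈-visited-retract l (l′ ∷ ls) hH (here eq) = ⊥-elim (H-leave l hH (H-after (l′ ∷ ls)) eq)
    ∈-visited-retract l (l′ ∷ ls) hH (there (here eq)) with collision l l′ hH (H-after ls) eq
    ... | inj₁ refl      = there (there (after∈visited ls))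
    ... | inj₂ (refl , _) = here refl
    ∈-visited-retract l (l′ ∷ ls) hH (there (there h∈)) =
      there (there (∈-visited-retract l ls hH h∈))

    player1-fresh : ∀ ls → Fresh ls → ∀ l → Legal (lastMove ls) (letter l) →
                    after ls ∙ letter l ∉ visited ls
    player1-fresh [] _ l _ (here eq) = H-leave l H-ε H-ε eq
    player1-fresh (l′ ∷ ls) _ l _ (here eq) = H-leave l (H-after (l′ ∷ ls)) (H-after (l′ ∷ ls)) eq
    player1-fresh (l′ ∷ ls) fresh l (_ , legal) (there (here eq))
      with collision l l′ (H-after (l′ ∷ ls)) (H-after ls) eq
    ... | inj₁ repeat   = fresh (there (subst (_∈ visited ls) (sym repeat) (after∈visited ls)))
    ... | inj₂ (_ , ill) = legal ill
    player1-fresh (l′ ∷ ls) fresh l _ (there (there q)) =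
      fresh (there (∈-visited-retract l ls (H-after (l′ ∷ ls)) q))

    player2-wins-from : ∀ ls → Fresh ls → Acc _<_ (unvisited (visited ls)) →
                        Lose (after ls) (visited ls) (lastMove ls)
    player2-wins-from ls fresh (acc rec) = lose respond
      where
      respond : ∀ g → Legal (lastMove ls) g →
                ¬ Repeats (after ls ∙ g) (visited ls) ×
                Win (after ls ∙ g) (after ls ∙ g ∷ visited ls) (just g)
      respond g legal with letter-onto (legal⇒InGens legal)
      ... | l , refl = new , answer (after (l ∷ ls) ∈? (after ls ∙ letter l ∷ visited ls))
        where
        new : after ls ∙ letter l ∉ visited ls
        new = player1-fresh ls fresh l legal
        answer : Dec (after (l ∷ ls) ∈ after ls ∙ letter l ∷ visited ls) →
                 Win (after ls ∙ letter l) (after ls ∙ letter l ∷ visited ls) (just (letter l))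
        answer (yes repeat) = win-now (reply l) (reply-legal l) repeat
        answer (no fresh′)  = win-move (reply l) (reply-legal l) fresh′
          (player2-wins-from (l ∷ ls) fresh′
            (rec (ℕ.<-trans (unvisited-∷ fresh′) (unvisited-∷ new))))

    player2-wins : Player2Wins
    player2-wins = player2-wins-from [] tt (<-wellFounded _)

-- The operations _⊕_, neg and zeroF of Dicyclic n unfold to those of ℤMod (2 * n), so the
-- abelian-group laws of ℤ/2n apply to them as they stand.
module DicyclicGroup (n : ℕ) .{{_ : NonZero n}} where
  open Dicyclic n
  open AbelianGroup (ℤMod.+-abelianGroup (2 * n)) using (assoc; comm; identityʳ; inverseʳ)
  open Algebra.Properties.AbelianGroup (ℤMod.+-abelianGroup (2 * n))
    using (⁻¹-involutive; ⁻¹-∙-comm; inverseʳ-unique; //-rightDividesˡ; //-rightDividesʳ)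
  open ℤMod (2 * n) using (toℕ-mod)
  open ≡-Reasoning

  n<2n : n < 2 * n
  n<2n = subst (n <_) (ℕ.*-comm n 2) (ℕ.m<m*n n 2 ℕ.≤-refl)

  toℕ-nF : toℕ nF ≡ n
  toℕ-nF = trans (toℕ-mod n) (m<n⇒m%n≡m n<2n)

  nF⊕nF : nF ⊕ nF ≡ zeroF
  nF⊕nF = ℤMod.mod-cong (2 * n) (begin
    (toℕ nF ℕ.+ toℕ nF) % (2 * n)  ≡⟨ cong (λ k → (k ℕ.+ k) % (2 * n)) toℕ-nF ⟩
    (n ℕ.+ n) % (2 * n)            ≡⟨ cong (λ k → (n ℕ.+ k) % (2 * n)) (ℕ.+-identityʳ n) ⟨
    (2 * n) % (2 * n)              ≡⟨ n%n≡0 (2 * n) ⟩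
    0                              ≡⟨ m*n%n≡0 0 (2 * n) ⟨
    0 % (2 * n)                    ∎)

  neg-nF : neg nF ≡ nF
  neg-nF = sym (inverseʳ-unique nF nF nF⊕nF)

  ⊕nF⊕nF : ∀ k → (k ⊕ nF) ⊕ nF ≡ k
  ⊕nF⊕nF k = trans (assoc k nF nF) (trans (cong (k ⊕_) nF⊕nF) (identityʳ k))

  inv-involutive : ∀ x → inv (inv x) ≡ x
  inv-involutive (k , false) = cong (_, false) (⁻¹-involutive k)
  inv-involutive (k , true)  = cong (_, true) (⊕nF⊕nF k)

  mul-inv-cancelʳ : ∀ x y → mul (mul x y) (inv y) ≡ x
  mul-inv-cancelʳ (k , false) (l , false) = cong (_, false) (//-rightDividesʳ l k)
  mul-inv-cancelʳ (k , false) (l , true)  = cong (_, false) (begin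
    ((k ⊕ l) ⊕ neg (l ⊕ nF)) ⊕ nF      ≡⟨ cong (λ z → ((k ⊕ l) ⊕ z) ⊕ nF) (⁻¹-∙-comm l nF) ⟨
    ((k ⊕ l) ⊕ (neg l ⊕ neg nF)) ⊕ nF  ≡⟨ cong (λ z → ((k ⊕ l) ⊕ (neg l ⊕ z)) ⊕ nF) neg-nF ⟩
    ((k ⊕ l) ⊕ (neg l ⊕ nF)) ⊕ nF      ≡⟨ assoc (k ⊕ l) (neg l ⊕ nF) nF ⟩
    (k ⊕ l) ⊕ ((neg l ⊕ nF) ⊕ nF)      ≡⟨ cong ((k ⊕ l) ⊕_) (⊕nF⊕nF (neg l)) ⟩
    (k ⊕ l) ⊕ neg l                    ≡⟨ //-rightDividesʳ l k ⟩
    k                                  ∎)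
  mul-inv-cancelʳ (k , true)  (l , false) = cong (_, true) (//-rightDividesʳ (neg l) k)
  mul-inv-cancelʳ (k , true)  (l , true)  = cong (_, true) (begin
    ((k ⊕ neg l) ⊕ nF) ⊕ (l ⊕ nF)   ≡⟨ cong (((k ⊕ neg l) ⊕ nF) ⊕_) (comm l nF) ⟩
    ((k ⊕ neg l) ⊕ nF) ⊕ (nF ⊕ l)   ≡⟨ assoc ((k ⊕ neg l) ⊕ nF) nF l ⟨
    (((k ⊕ neg l) ⊕ nF) ⊕ nF) ⊕ l   ≡⟨ cong (_⊕ l) (⊕nF⊕nF (k ⊕ neg l)) ⟩
    (k ⊕ neg l) ⊕ l                 ≡⟨ //-rightDividesˡ l k ⟩
    k                               ∎)

  _≟_ : DecidableEquality Elt
  _≟_ = ≡-dec Fin._≟_ Bool._≟_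

  elements : List Elt
  elements = cartesianProduct (allFin (2 * n)) (false ∷ true ∷ [])

  ∈-elements : ∀ x → x ∈ elements
  ∈-elements (k , false) = ∈-cartesianProduct⁺ (∈-allFin k) (here refl)
  ∈-elements (k , true)  = ∈-cartesianProduct⁺ (∈-allFin k) (there (here refl))

module DicyclicCosets (n : ℕ) .{{_ : NonZero n}} (n≥3 : 3 ≤ n) (n-odd : n % 2 ≡ 1) where
  open Dicyclic n
  open DicyclicGroup n
  open ℤMod (2 * n) using (toℕ-mod)
  open ℤMod.Parity (2 * n) (m∣m*n n)
  open AbelianGroup (ℤMod.+-abelianGroup (2 * n)) using (identityˡ; inverseʳ)
  open ≡-Reasoning

  -- The nontrivial cosets of H; under Dic_n / H ≅ ℤ/4 they are 2, 1 and 3.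
  data Coset : Set where
    αH xH αxH : Coset

  coset⁻¹ : Coset → Coset
  coset⁻¹ αH  = αH
  coset⁻¹ xH  = αxH
  coset⁻¹ αxH = xH

  Letter : Set
  Letter = Coset × Bool

  letter : Letter → Elt
  letter (αH  , true)  = gen-a
  letter (αH  , false) = inv gen-a
  letter (xH  , true)  = gen-b
  letter (xH  , false) = inv gen-c
  letter (αxH , true)  = gen-c
  letter (αxH , false) = inv gen-b

  partner : Letter → Letter
  partner (C , s) = (C , not s)

  reply : Letter → Elt
  reply (C , s) = letter (coset⁻¹ C , s)

  xExponent : Coset → Bool
  xExponent αH  = false
  xExponent xH  = true
  xExponent αxH = true

  αParity : Coset → ℕ
  αParity αH  = 1
  αParity xH  = 0
  αParity αxH = 1

  InH : Elt → Set
  InH (k , t) = t ≡ false × parity k ≡ 0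

  InCoset : Coset → Elt → Set
  InCoset C (k , t) = t ≡ xExponent C × parity k ≡ αParity C

  2n≡n+n : 2 * n ≡ n ℕ.+ n
  2n≡n+n = cong (n ℕ.+_) (ℕ.+-identityʳ n)

  1+n<2n : suc n < 2 * n
  1+n<2n = subst (suc n <_) (sym 2n≡n+n) (ℕ.+-monoˡ-< n (ℕ.≤-trans (ℕ.n≤1+n 2) n≥3))

  toℕ-mod-small : ∀ {k} → k ≤ suc n → toℕ (k mod (2 * n)) ≡ k
  toℕ-mod-small {k} k≤1+n = trans (toℕ-mod k) (m<n⇒m%n≡m (ℕ.≤-<-trans k≤1+n 1+n<2n))

  toℕ-zeroF : toℕ zeroF ≡ 0
  toℕ-zeroF = toℕ-mod-small ℕ.z≤n

  toℕ-oneF : toℕ oneF ≡ 1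
  toℕ-oneF = toℕ-mod-small (ℕ.s≤s ℕ.z≤n)

  parity-⊕ : ∀ i j {a b} → parity i ≡ a → parity j ≡ b → parity (i ⊕ j) ≡ (a ℕ.+ b) % 2
  parity-⊕ i j refl refl = parity-+ i j

  parity-oneF : parity oneF ≡ 1
  parity-oneF = cong (_% 2) toℕ-oneF

  parity-nF : parity nF ≡ 1
  parity-nF = trans (cong (_% 2) toℕ-nF) n-odd

  letter-InCoset : ∀ l → InCoset (proj₁ l) (letter l)
  letter-InCoset (αH  , true)  = refl , parity-oneF
  letter-InCoset (αH  , false) = refl , trans (parity-neg oneF) parity-oneF
  letter-InCoset (xH  , true)  = refl , parity-0#
  letter-InCoset (xH  , false) = refl , parity-⊕ oneF nF parity-oneF parity-nF
  letter-InCoset (αxH , true)  = refl , parity-oneF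
  letter-InCoset (αxH , false) = refl , parity-⊕ zeroF nF parity-0# parity-nF

  InH-ε : InH (zeroF , false)
  InH-ε = refl , parity-0#

  InH-mul : ∀ {C} h y → InH h → InCoset C y → InCoset C (mul h y)
  InH-mul {C} (k , _) (l , _) (refl , pk) (refl , pl) = refl , (begin
    parity (k ⊕ l)        ≡⟨ parity-⊕ k l pk refl ⟩
    (0 ℕ.+ parity l) % 2  ≡⟨ m%n%n≡m%n (toℕ l) 2 ⟩
    parity l              ≡⟨ pl ⟩
    αParity C             ∎)

  InCoset-unique : ∀ {C C′} y → InCoset C y → InCoset C′ y → C ≡ C′
  InCoset-unique {αH}  {αH}   _ _ _ = refl
  InCoset-unique {xH}  {xH}   _ _ _ = refl
  InCoset-unique {αxH} {αxH}  _ _ _ = refl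
  InCoset-unique {αH}  {xH}   _ (refl , _) (() , _)
  InCoset-unique {αH}  {αxH}  _ (refl , _) (() , _)
  InCoset-unique {xH}  {αH}   _ (refl , _) (() , _)
  InCoset-unique {αxH} {αH}   _ (refl , _) (() , _)
  InCoset-unique {xH}  {αxH}  _ (_ , p) (_ , q) with () ← trans (sym p) q
  InCoset-unique {αxH} {xH}   _ (_ , p) (_ , q) with () ← trans (sym p) q

  InCoset⇒∉H : ∀ {C} y → InCoset C y → ¬ InH y
  InCoset⇒∉H {αH}  _ (_ , p) (_ , q) with () ← trans (sym p) q
  InCoset⇒∉H {xH}  _ (refl , _) (() , _)
  InCoset⇒∉H {αxH} _ (refl , _) (() , _)

  InCoset-mul-inverse : ∀ {C} x y → InCoset C x → InCoset (coset⁻¹ C) y → InH (mul x y)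
  InCoset-mul-inverse {αH}  (k , _) (l , _) (refl , pk) (refl , pl) = refl , parity-⊕ k l pk pl
  InCoset-mul-inverse {xH}  (k , _) (l , _) (refl , pk) (refl , pl) =
    refl , parity-⊕ (k ⊕ neg l) nF (parity-⊕ k (neg l) pk (trans (parity-neg l) pl)) parity-nF
  InCoset-mul-inverse {αxH} (k , _) (l , _) (refl , pk) (refl , pl) =
    refl , parity-⊕ (k ⊕ neg l) nF (parity-⊕ k (neg l) pk (trans (parity-neg l) pl)) parity-nF

  letter-partner-distinct : ∀ l → letter l ≢ letter (partner l)
  letter-partner-distinct (C , true)  = distinct C
    where
    distinct : ∀ C → letter (C , true) ≢ letter (C , false)
    distinct αH eq with () ← begin
      2                               ≡⟨ toℕ-mod-small (ℕ.m≤n⇒m≤1+n (ℕ.≤-trans (ℕ.n≤1+n 2) n≥3)) ⟨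
      toℕ (2 mod (2 * n))             ≡⟨ cong (λ a → toℕ ((a ℕ.+ a) mod (2 * n))) toℕ-oneF ⟨
      toℕ (oneF ⊕ oneF)               ≡⟨ cong (λ k → toℕ (oneF ⊕ k)) (cong proj₁ eq) ⟩
      toℕ (oneF ⊕ neg oneF)           ≡⟨ cong toℕ (inverseʳ oneF) ⟩
      toℕ zeroF                       ≡⟨ toℕ-zeroF ⟩
      0                               ∎
    distinct xH eq with () ← begin
      0                               ≡⟨ toℕ-zeroF ⟨
      toℕ zeroF                       ≡⟨ cong (toℕ ∘ proj₁) eq ⟩
      toℕ (oneF ⊕ nF)                 ≡⟨ toℕ-mod _ ⟩
      (toℕ oneF ℕ.+ toℕ nF) % (2 * n) ≡⟨ cong₂ (λ a b → (a ℕ.+ b) % (2 * n)) toℕ-oneF toℕ-nF ⟩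
      suc n % (2 * n)                 ≡⟨ m<n⇒m%n≡m 1+n<2n ⟩
      suc n                           ∎
    distinct αxH eq with ℕ.s≤s () ← subst (3 ≤_) (begin
      n                               ≡⟨ toℕ-nF ⟨
      toℕ nF                          ≡⟨ cong toℕ (identityˡ nF) ⟨
      toℕ (zeroF ⊕ nF)                ≡⟨ cong (toℕ ∘ proj₁) eq ⟨
      toℕ oneF                        ≡⟨ toℕ-oneF ⟩
      1                               ∎) n≥3
  letter-partner-distinct (C , false) = letter-partner-distinct (C , true) ∘ sym

  inv-letter : ∀ l → inv (letter l) ≡ reply (partner l)
  inv-letter (αH  , true)  = refl
  inv-letter (αH  , false) = inv-involutive gen-a
  inv-letter (xH  , true)  = refl
  inv-letter (xH  , false) = inv-involutive gen-c
  inv-letter (αxH , true)  = refl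
  inv-letter (αxH , false) = inv-involutive gen-b

  letter≡inv-reply-partner : ∀ l → letter l ≡ inv (reply (partner l))
  letter≡inv-reply-partner l = trans (sym (inv-involutive (letter l))) (cong inv (inv-letter l))

  open REL Dic gens using (InGens; Legal)

  letter-InGens : ∀ l → InGens (letter l)
  letter-InGens (αH  , true)  = inj₁ (here refl)
  letter-InGens (xH  , true)  = inj₁ (there (here refl))
  letter-InGens (αxH , true)  = inj₁ (there (there (here refl)))
  letter-InGens (αH  , false) = inj₂ (here refl)
  letter-InGens (αxH , false) = inj₂ (there (here refl))
  letter-InGens (xH  , false) = inj₂ (there (there (here refl)))

  InGens⇒letter : ∀ {g} → InGens g → ∃[ l ] g ≡ letter l
  InGens⇒letter (inj₁ (here eq))                 = (αH  , true)  , eq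
  InGens⇒letter (inj₁ (there (here eq)))         = (xH  , true)  , eq
  InGens⇒letter (inj₁ (there (there (here eq)))) = (αxH , true)  , eq
  InGens⇒letter (inj₂ (here eq))                 = (αH  , false) , eq
  InGens⇒letter (inj₂ (there (here eq)))         = (αxH , false) , eq
  InGens⇒letter (inj₂ (there (there (here eq)))) = (xH  , false) , eq

  reply-legal : ∀ l → Legal (just (letter l)) (reply l)
  reply-legal (C , s) = letter-InGens (coset⁻¹ C , s) ,
    λ eq → letter-partner-distinct (coset⁻¹ C , s) (trans eq (inv-letter (C , s)))

  letters-of-coset : ∀ C s s′ →
    letter (C , s) ≡ letter (C , s′) ⊎ letter (C , s) ≡ inv (reply (C , s′))
  letters-of-coset C true  true  = inj₁ refl
  letters-of-coset C false false = inj₁ refl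
  letters-of-coset C true  false = inj₂ (letter≡inv-reply-partner (C , true))
  letters-of-coset C false true  = inj₂ (letter≡inv-reply-partner (C , false))

  InH-mul-letter : ∀ h l → InH h → InCoset (proj₁ l) (mul h (letter l))
  InH-mul-letter h l hH = InH-mul h (letter l) hH (letter-InCoset l)

  InH-round : ∀ {h} l → InH h → InH (mul (mul h (letter l)) (reply l))
  InH-round {h} (C , s) hH =
    InCoset-mul-inverse (mul h (letter (C , s))) (reply (C , s))
      (InH-mul-letter h (C , s) hH) (letter-InCoset (coset⁻¹ C , s))

  InH-leave : ∀ {h h′} l → InH h → InH h′ → mul h (letter l) ≢ h′
  InH-leave {h} l hH h′H eq =
    InCoset⇒∉H (mul h (letter l)) (InH-mul-letter h l hH) (subst InH (sym eq) h′H)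

  InH-collide : ∀ {h h′} l l′ → InH h → InH h′ → mul h (letter l) ≡ mul h′ (letter l′) →
                letter l ≡ letter l′ ⊎ letter l ≡ inv (reply l′)
  InH-collide {h} {h′} (C , s) (C′ , s′) hH h′H eq
    with refl ← InCoset-unique (mul h (letter (C , s))) (InH-mul-letter h (C , s) hH)
                  (subst (InCoset C′) (sym eq) (InH-mul-letter h′ (C′ , s′) h′H))
    = letters-of-coset C s s′

theorem4p7 : (n : ℕ) .{{_ : NonZero n}} → 3 ≤ n → n % 2 ≡ 1 →
    REL.Player2Wins (Dicyclic.Dic n) (Dicyclic.gens n)
theorem4p7 n n≥3 n-odd =
  PairingStrategy.player2-wins mul (zeroF , false) inv gens
    _≟_ elements ∈-elements mul-inv-cancelʳ
    letter InGens⇒letter reply reply-legal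
    InH InH-ε InH-round InH-leave InH-collide
  where
  open Dicyclic n
  open DicyclicGroup n
  open DicyclicCosets n n≥3 n-odd
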